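{- The following two statements are equivalent: (i) there is a constant $C>0$ such that $RP(n)\le C^n$ for all positive integers $n$; (ii) there is a constant $C>0$ such that $H_n(K_{2,4})\le C^n$ for all positive integers $n$.
   Context: Two permutations $\pi_1,\pi_2$ of $[n]=\{1,\dots,n\}$, viewed as vectors $(\pi(1),\dots,\pi(n))$, are called reversing if there are two coordinates $i\ne j$ containing the same two elements in reversed order, i.e. $\pi_1(i)=\pi_2(j)$ and $\pi_1(j)=\pi_2(i)$. $RP(n)$ denotes the maximum number of pairwise reversing permutations of $[n]$. Two graphs on the same vertex set are called $G$-creating if the union of their edge sets contains $G$ as a (not necessarily induced) subgraph; $H_n(G)$ denotes the maximum number of Hamiltonian paths of the complete graph $K_n$ that are pairwise $G$-creating. $K_{2,4}$ is the complete bipartite graph with parts of sizes $2$ and $4$. -}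

module Defs where

open import Data.Nat using (ℕ; suc; _≤_; _<_; _^_)
open import Data.Fin using (Fin; toℕ)
open import Data.Fin.Permutation using (Permutation′; _⟨$⟩ʳ_)
open import Data.Product using (Σ; ∃-syntax; _×_)
open import Data.Sum using (_⊎_; inj₁; inj₂)
open import Relation.Binary.PropositionalEquality using (_≡_; _≢_)
open import Function.Definitions using (Injective)

Reversing : ∀ {n} → Permutation′ n → Permutation′ n → Set
Reversing {n} π₁ π₂ =
  ∃[ i ] ∃[ j ] (i ≢ j × (π₁ ⟨$⟩ʳ i ≡ π₂ ⟨$⟩ʳ j) × (π₁ ⟨$⟩ʳ j ≡ π₂ ⟨$⟩ʳ i))

PairwiseFam : ∀ {X : Set} → (X → X → Set) → ∀ {m} → (Fin m → X) → Set
PairwiseFam R {m} F = ∀ (a b : Fin m) → a ≢ b → R (F a) (F b)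

-- A Hamiltonian path of K_n is given by a vertex ordering σ (a permutation of [n]);
-- its edges are the pairs {σ(k), σ(k+1)}.  (σ and its reversal give the same path.)
PathAdj : ∀ {n} → Permutation′ n → Fin n → Fin n → Set
PathAdj {n} σ u v =
  ∃[ i ] ∃[ j ] (toℕ j ≡ suc (toℕ i) ×
    ((σ ⟨$⟩ʳ i ≡ u × σ ⟨$⟩ʳ j ≡ v) ⊎ (σ ⟨$⟩ʳ i ≡ v × σ ⟨$⟩ʳ j ≡ u)))

UnionAdj : ∀ {n} → Permutation′ n → Permutation′ n → Fin n → Fin n → Set
UnionAdj σ τ u v = PathAdj σ u v ⊎ PathAdj τ u v

-- The union of the two paths contains K_{2,4} (parts Fin 2 and Fin 4) as a
-- (not necessarily induced) subgraph: an injective vertex map sending every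
-- edge of K_{2,4} to an edge of the union.
K24Creating : ∀ {n} → Permutation′ n → Permutation′ n → Set
K24Creating {n} σ τ =
  Σ (Fin 2 ⊎ Fin 4 → Fin n) λ h →
    Injective _≡_ _≡_ h × (∀ (a : Fin 2) (b : Fin 4) → UnionAdj σ τ (h (inj₁ a)) (h (inj₂ b)))

RPBound : ℕ → ℕ → Set
RPBound n B = ∀ (m : ℕ) (F : Fin m → Permutation′ n) → PairwiseFam Reversing F → m ≤ B

HBound : ℕ → ℕ → Set
HBound n B = ∀ (m : ℕ) (P : Fin m → Permutation′ n) → PairwiseFam K24Creating P → m ≤ B

module Submission where

-- Each direction is an encoding of permutations of [n] into permutations of [kn] (built as
-- bijections of the grid Fin n × Fin k of blocks and slots) that turns one pairwise relation
-- into the other; `transfer` then turns a bound C^N for one into (C^k)^n for the other.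
-- (ii ⇒ i), k = 3: π becomes the Hamiltonian path (π0,0),(0,1),(π0,2),(π1,0),(1,1),…;
-- if π₁, π₂ reverse at i, j then the middle vertices (i,1),(j,1) are joined to the outer
-- vertices of u = π₁i and v = π₁j in the union of the two paths (`reversing⇒k24`).
-- (i ⇒ ii), k = 5: a path σ becomes the permutation sending (v,0) to (successor of v, 0) and
-- permuting (v,1..4) by a Klein involution chosen by the position of v mod 3.  Where two
-- paths disagree on positions mod 3 the Klein blocks reverse; otherwise the positions form a
-- common grading in which path edges climb by one, and counting the four kinds of edges at a
-- vertex of degree 4 shows that a K_{2,4} forces x ≠ y whose successors are swapped
-- (`k24⇒crossing`), a reversal at (x,0),(y,0) (`k24⇒reversing`).

open import Defs
open import Data.Nat using (ℕ; zero; suc; _+_; _*_; _≤_; _<_; _^_; NonZero; >-nonZero)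
open import Data.Nat.Properties
  using (+-suc; *-comm; ^-*-assoc; m≤m*n; ≤-trans; m^n>0; 1+n≰n; suc-injective)
open import Data.Fin using (Fin; zero; suc; toℕ; fromℕ; inject₁; punchIn; punchOut; combine; remQuot)
open import Data.Fin.Properties
  using (toℕ-injective; toℕ-inject₁; toℕ-combine; combine-injective; remQuot-combine; *↔×;
         _≟_; any?; all?; ¬∀⟶∃¬; punchOut-injective; injective⇒≤)
  renaming (suc-injective to fin-suc-injective)
open import Data.Fin.Permutation
  using (Permutation′; _⟨$⟩ʳ_; _⟨$⟩ˡ_; permutation; inverseˡ; inverseʳ; id; flip; _∘ₚ_;
         insert; insert-punchIn; lift₀)
open import Data.Product using (∃-syntax; _×_; _,_; proj₁; proj₂; uncurry)
open import Data.Product.Properties using (,-injectiveˡ; ,-injectiveʳ)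
open import Data.Sum using (_⊎_; inj₁; inj₂; [_,_]′) renaming (map to ⊎-map)
open import Data.Sum.Properties using (inj₂-injective)
open import Relation.Nullary using (yes; no; contradiction)
open import Relation.Binary.PropositionalEquality
open import Function using (_∘_; _↔_; Injection; Inverse; mk↔ₛ′)
open import Function.Bundles using (_⇔_; mk⇔)
open import Function.Definitions using (Injective)
open import Function.Properties.Inverse using (↔⇒↣)
open import Function.Construct.Composition using (_↔-∘_)
open import Function.Construct.Symmetry using (↔-sym)

open ≡-Reasoning

↔-injective : ∀ {A B : Set} (f : A ↔ B) → Injective _≡_ _≡_ (Inverse.to f)
↔-injective f = Injection.injective (↔⇒↣ f)

-- Via the identification Fin (n * k) ≅ Fin n × Fin k (coordinate `combine a t` is slot t
-- of block a), every bijection of the grid is a permutation of [nk].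
gridPermutation : ∀ {n k} → (Fin n × Fin k) ↔ (Fin n × Fin k) → Permutation′ (n * k)
gridPermutation ψ = ↔-sym *↔× ↔-∘ (ψ ↔-∘ *↔×)

acrossBlocks : ∀ {n k} → (Fin k → Permutation′ n) → Permutation′ (n * k)
acrossBlocks {n} {k} π = gridPermutation (mk↔ₛ′ to from to∘from from∘to)
  where
  to from : Fin n × Fin k → Fin n × Fin k
  to (a , t) = π t ⟨$⟩ʳ a , t
  from (a , t) = π t ⟨$⟩ˡ a , t
  to∘from : ∀ p → to (from p) ≡ p
  to∘from (a , t) = cong (_, t) (inverseʳ (π t))
  from∘to : ∀ p → from (to p) ≡ p
  from∘to (a , t) = cong (_, t) (inverseˡ (π t))

acrossBlocks-combine : ∀ {n k} (π : Fin k → Permutation′ n) a t →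
  acrossBlocks π ⟨$⟩ʳ combine a t ≡ combine (π t ⟨$⟩ʳ a) t
acrossBlocks-combine π a t = cong (λ (a , t) → combine (π t ⟨$⟩ʳ a) t) (remQuot-combine a t)

withinBlocks : ∀ {n k} → (Fin n → Permutation′ k) → Permutation′ (n * k)
withinBlocks {n} {k} κ = gridPermutation (mk↔ₛ′ to from to∘from from∘to)
  where
  to from : Fin n × Fin k → Fin n × Fin k
  to (a , t) = a , κ a ⟨$⟩ʳ t
  from (a , t) = a , κ a ⟨$⟩ˡ t
  to∘from : ∀ p → to (from p) ≡ p
  to∘from (a , t) = cong (a ,_) (inverseʳ (κ a))
  from∘to : ∀ p → from (to p) ≡ p
  from∘to (a , t) = cong (a ,_) (inverseˡ (κ a))

withinBlocks-combine : ∀ {n k} (κ : Fin n → Permutation′ k) a t →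
  withinBlocks κ ⟨$⟩ʳ combine a t ≡ combine a (κ a ⟨$⟩ʳ t)
withinBlocks-combine κ a t = cong (λ (a , t) → combine a (κ a ⟨$⟩ʳ t)) (remQuot-combine a t)

combine-consecutive : ∀ {n k} (a : Fin n) {s t : Fin k} →
  toℕ t ≡ suc (toℕ s) → toℕ (combine a t) ≡ suc (toℕ (combine a s))
combine-consecutive {k = k} a {s} {t} t≡s+1 = begin
  toℕ (combine a t)         ≡⟨ toℕ-combine a t ⟩
  k * toℕ a + toℕ t         ≡⟨ cong (k * toℕ a +_) t≡s+1 ⟩
  k * toℕ a + suc (toℕ s)   ≡⟨ +-suc (k * toℕ a) (toℕ s) ⟩
  suc (k * toℕ a + toℕ s)   ≡⟨ cong suc (toℕ-combine a s) ⟨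
  suc (toℕ (combine a s))   ∎

record Next {n} (π : Permutation′ n) (u w : Fin n) : Set where
  constructor consecutive
  field
    i j   : Fin n
    j≡i+1 : toℕ j ≡ suc (toℕ i)
    π-i   : π ⟨$⟩ʳ i ≡ u
    π-j   : π ⟨$⟩ʳ j ≡ w

next-functional : ∀ {n} {π : Permutation′ n} {u w w′} → Next π u w → Next π u w′ → w ≡ w′
next-functional {π = π} (consecutive i j j≡i+1 refl refl) (consecutive i′ j′ j′≡i′+1 πi′≡πi refl) =
  cong (π ⟨$⟩ʳ_) (toℕ-injective (begin
    toℕ j          ≡⟨ j≡i+1 ⟩
    suc (toℕ i)    ≡⟨ cong (suc ∘ toℕ) (↔-injective π πi′≡πi) ⟨
    suc (toℕ i′)   ≡⟨ j′≡i′+1 ⟨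
    toℕ j′         ∎))

next-injective : ∀ {n} {π : Permutation′ n} {u u′ w} → Next π u w → Next π u′ w → u ≡ u′
next-injective {π = π} (consecutive i j j≡i+1 refl refl) (consecutive i′ j′ j′≡i′+1 refl πj′≡πj) =
  cong (π ⟨$⟩ʳ_) (toℕ-injective (suc-injective (begin
    suc (toℕ i)    ≡⟨ j≡i+1 ⟨
    toℕ j          ≡⟨ cong toℕ (↔-injective π πj′≡πj) ⟨
    toℕ j′         ≡⟨ j′≡i′+1 ⟩
    suc (toℕ i′)   ∎)))

pathAdj-split : ∀ {n} {π : Permutation′ n} {u w} → PathAdj π u w → Next π u w ⊎ Next π w u
pathAdj-split (i , j , j≡i+1 , inj₁ (πi≡u , πj≡w)) = inj₁ (consecutive i j j≡i+1 πi≡u πj≡w)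
pathAdj-split (i , j , j≡i+1 , inj₂ (πi≡w , πj≡u)) = inj₂ (consecutive i j j≡i+1 πi≡w πj≡u)

next⇒pathAdj : ∀ {n} {π : Permutation′ n} {u w} → Next π u w → PathAdj π u w
next⇒pathAdj (consecutive i j j≡i+1 πi≡u πj≡w) = i , j , j≡i+1 , inj₁ (πi≡u , πj≡w)

prev⇒pathAdj : ∀ {n} {π : Permutation′ n} {u w} → Next π w u → PathAdj π u w
prev⇒pathAdj (consecutive i j j≡i+1 πi≡w πj≡u) = i , j , j≡i+1 , inj₂ (πi≡w , πj≡u)

-- The path of π: slot 1 of block k holds k itself, slots 0 and 2 hold π k.
pathLayer : ∀ {n} → Permutation′ n → Fin 3 → Permutation′ n
pathLayer π zero             = π
pathLayer π (suc zero)       = id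
pathLayer π (suc (suc zero)) = π

pathOf : ∀ {n} → Permutation′ n → Permutation′ (n * 3)
pathOf π = acrossBlocks (pathLayer π)

middle : Fin 3
middle = suc zero

pick : ∀ {A : Set} → A → A → Fin 2 → A
pick a b zero       = a
pick a b (suc zero) = b

pick-injective : ∀ {A : Set} {a b : A} → a ≢ b → Injective _≡_ _≡_ (pick a b)
pick-injective a≢b {zero}     {zero}     _   = refl
pick-injective a≢b {zero}     {suc zero} a≡b = contradiction a≡b a≢b
pick-injective a≢b {suc zero} {zero}     b≡a = contradiction (sym b≡a) a≢b
pick-injective a≢b {suc zero} {suc zero} _   = refl

outer : Fin 2 → Fin 3
outer = pick zero (suc (suc zero))

middle≢outer : ∀ s → middle ≢ outer s
middle≢outer zero       ()
middle≢outer (suc zero) ()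

pathOf-neighbours : ∀ {n} (π : Permutation′ n) {k w} → π ⟨$⟩ʳ k ≡ w →
  ∀ s → PathAdj (pathOf π) (combine k middle) (combine w (outer s))
pathOf-neighbours π {k} refl zero = prev⇒pathAdj {π = pathOf π}
  (consecutive (combine k zero) (combine k middle) (combine-consecutive k refl)
   (acrossBlocks-combine (pathLayer π) k zero) (acrossBlocks-combine (pathLayer π) k middle))
pathOf-neighbours π {k} refl (suc zero) = next⇒pathAdj {π = pathOf π}
  (consecutive (combine k middle) (combine k (suc (suc zero))) (combine-consecutive k refl)
   (acrossBlocks-combine (pathLayer π) k middle) (acrossBlocks-combine (pathLayer π) k (suc (suc zero))))

-- A reversal of π₁, π₂ at coordinates i, j gives the K_{2,4} with parts the middle vertices
-- of i, j and the outer vertices of u = π₁ i and v = π₁ j (Fin 4 ≅ Fin 2 × Fin 2 picks u/v and side).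
reversing⇒k24 : ∀ {n} {π₁ π₂ : Permutation′ n} → Reversing π₁ π₂ → K24Creating (pathOf π₁) (pathOf π₂)
reversing⇒k24 {n} {π₁} {π₂} (i , j , i≢j , π₁i≡π₂j , π₁j≡π₂i) =
  uncurry combine ∘ place , place-injective ∘ ↔-injective (↔-sym *↔×) , adjacent
  where
  u v : Fin n
  u = π₁ ⟨$⟩ʳ i
  v = π₁ ⟨$⟩ʳ j

  place : Fin 2 ⊎ Fin 4 → Fin n × Fin 3
  place (inj₁ a) = pick i j a , middle
  place (inj₂ b) = pick u v (proj₁ (remQuot {2} 2 b)) , outer (proj₂ (remQuot {2} 2 b))

  place-injective : Injective _≡_ _≡_ place
  place-injective {inj₁ a} {inj₁ a′} eq = cong inj₁ (pick-injective i≢j (,-injectiveˡ eq))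
  place-injective {inj₁ a} {inj₂ b}  eq = contradiction (,-injectiveʳ eq) (middle≢outer _)
  place-injective {inj₂ b} {inj₁ a}  eq = contradiction (sym (,-injectiveʳ eq)) (middle≢outer _)
  place-injective {inj₂ b} {inj₂ b′} eq = cong inj₂ (↔-injective *↔× (cong₂ _,_
    (pick-injective (i≢j ∘ ↔-injective π₁) (,-injectiveˡ eq))
    (pick-injective (λ ()) (,-injectiveʳ eq))))

  reaches : ∀ a e → π₁ ⟨$⟩ʳ pick i j a ≡ pick u v e ⊎ π₂ ⟨$⟩ʳ pick i j a ≡ pick u v e
  reaches zero       zero       = inj₁ refl
  reaches zero       (suc zero) = inj₂ (sym π₁j≡π₂i)
  reaches (suc zero) zero       = inj₂ (sym π₁i≡π₂j)
  reaches (suc zero) (suc zero) = inj₁ refl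

  adjacent : ∀ a b → UnionAdj (pathOf π₁) (pathOf π₂) (combine (pick i j a) middle)
                                                     (uncurry combine (place (inj₂ b)))
  adjacent a b = ⊎-map (λ e → pathOf-neighbours π₁ e side) (λ e → pathOf-neighbours π₂ e side)
                       (reaches a (proj₁ (remQuot {2} 2 b)))
    where side = proj₂ (remQuot {2} 2 b)

punchIn-fromℕ : ∀ {n} (k : Fin n) → punchIn (fromℕ n) k ≡ inject₁ k
punchIn-fromℕ zero    = refl
punchIn-fromℕ (suc k) = cong suc (punchIn-fromℕ k)

cyclicShift : ∀ n → Permutation′ n
cyclicShift zero    = id
cyclicShift (suc n) = insert (fromℕ n) zero id

cyclicShift-step : ∀ {n} {i j : Fin n} → toℕ j ≡ suc (toℕ i) → cyclicShift n ⟨$⟩ʳ i ≡ j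
cyclicShift-step {suc n} {i} {suc k} k+1≡i+1 = begin
  shift ⟨$⟩ʳ i                       ≡⟨ cong (shift ⟨$⟩ʳ_) i≡k ⟩
  shift ⟨$⟩ʳ inject₁ k               ≡⟨ cong (shift ⟨$⟩ʳ_) (punchIn-fromℕ k) ⟨
  shift ⟨$⟩ʳ punchIn (fromℕ n) k     ≡⟨ insert-punchIn (fromℕ n) zero id k ⟩
  suc k                              ∎
  where
  shift = cyclicShift (suc n)
  i≡k : i ≡ inject₁ k
  i≡k = toℕ-injective (trans (sym (suc-injective k+1≡i+1)) (sym (toℕ-inject₁ k)))

-- The successor map of the path σ, closed up into a permutation of the vertices.
successor : ∀ {n} → Permutation′ n → Permutation′ n
successor {n} σ = flip σ ∘ₚ cyclicShift n ∘ₚ σ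

successor-next : ∀ {n} {σ : Permutation′ n} {u w} → Next σ u w → successor σ ⟨$⟩ʳ u ≡ w
successor-next {n} {σ} (consecutive i j j≡i+1 refl refl) =
  cong (σ ⟨$⟩ʳ_) (trans (cong (cyclicShift n ⟨$⟩ʳ_) (inverseˡ σ)) (cyclicShift-step j≡i+1))

suc₃ : Fin 3 → Fin 3
suc₃ zero             = suc zero
suc₃ (suc zero)       = suc (suc zero)
suc₃ (suc (suc zero)) = zero

mod₃ : ℕ → Fin 3
mod₃ zero    = zero
mod₃ (suc m) = suc₃ (mod₃ m)

suc₃-cube : ∀ r → suc₃ (suc₃ (suc₃ r)) ≡ r
suc₃-cube zero             = refl
suc₃-cube (suc zero)       = refl
suc₃-cube (suc (suc zero)) = refl

suc₃-no-fixpoint : ∀ r → suc₃ r ≢ r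
suc₃-no-fixpoint zero             ()
suc₃-no-fixpoint (suc zero)       ()
suc₃-no-fixpoint (suc (suc zero)) ()

suc₃-no-2-cycle : ∀ r → suc₃ (suc₃ r) ≢ r
suc₃-no-2-cycle zero             ()
suc₃-no-2-cycle (suc zero)       ()
suc₃-no-2-cycle (suc (suc zero)) ()

remaining-residue : ∀ r c → c ≢ suc₃ r → c ≢ suc₃ (suc₃ r) → c ≡ r
remaining-residue zero             zero             _  _  = refl
remaining-residue zero             (suc zero)       ne _  = contradiction refl ne
remaining-residue zero             (suc (suc zero)) _  ne = contradiction refl ne
remaining-residue (suc zero)       zero             _  ne = contradiction refl ne
remaining-residue (suc zero)       (suc zero)       _  _  = refl
remaining-residue (suc zero)       (suc (suc zero)) ne _  = contradiction refl ne
remaining-residue (suc (suc zero)) zero             ne _  = contradiction refl ne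
remaining-residue (suc (suc zero)) (suc zero)       _  ne = contradiction refl ne
remaining-residue (suc (suc zero)) (suc (suc zero)) _  _  = refl

Graded : ∀ {n} → (Fin n → Fin 3) → Permutation′ n → Set
Graded c π = ∀ {u w} → Next π u w → c w ≡ suc₃ (c u)

position₃ : ∀ {n} → Permutation′ n → Fin n → Fin 3
position₃ π v = mod₃ (toℕ (π ⟨$⟩ˡ v))

position₃-graded : ∀ {n} (π : Permutation′ n) → Graded (position₃ π) π
position₃-graded π (consecutive i j j≡i+1 refl refl) = begin
  mod₃ (toℕ (π ⟨$⟩ˡ (π ⟨$⟩ʳ j)))          ≡⟨ cong (mod₃ ∘ toℕ) (inverseˡ π) ⟩
  mod₃ (toℕ j)                           ≡⟨ cong mod₃ j≡i+1 ⟩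
  suc₃ (mod₃ (toℕ i))                    ≡⟨ cong (suc₃ ∘ mod₃ ∘ toℕ) (inverseˡ π) ⟨
  suc₃ (mod₃ (toℕ (π ⟨$⟩ˡ (π ⟨$⟩ʳ i))))   ∎

regrade : ∀ {n} {c c′ : Fin n → Fin 3} {π} → (∀ v → c v ≡ c′ v) → Graded c′ π → Graded c π
regrade {c = c} {c′} c≗c′ graded {u} {w} u→w = begin
  c w             ≡⟨ c≗c′ w ⟩
  c′ w            ≡⟨ graded u→w ⟩
  suc₃ (c′ u)     ≡⟨ cong suc₃ (c≗c′ u) ⟨
  suc₃ (c u)      ∎

Step : ∀ {n} → Permutation′ n → Permutation′ n → Fin 4 → Fin n → Fin n → Set
Step σ τ zero                   u w = Next σ u w
Step σ τ (suc zero)             u w = Next σ w u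
Step σ τ (suc (suc zero))       u w = Next τ u w
Step σ τ (suc (suc (suc zero))) u w = Next τ w u

unionAdj⇒step : ∀ {n} {σ τ : Permutation′ n} {u w} → UnionAdj σ τ u w → ∃[ k ] Step σ τ k u w
unionAdj⇒step {σ = σ} (inj₁ adj) =
  [ (λ s → zero , s) , (λ s → suc zero , s) ]′ (pathAdj-split {π = σ} adj)
unionAdj⇒step {τ = τ} (inj₂ adj) =
  [ (λ s → suc (suc zero) , s) , (λ s → suc (suc (suc zero)) , s) ]′ (pathAdj-split {π = τ} adj)

step-functional : ∀ {n} {σ τ : Permutation′ n} k {u w w′} →
  Step σ τ k u w → Step σ τ k u w′ → w ≡ w′
step-functional zero                   = next-functional
step-functional (suc zero)             = next-injective
step-functional (suc (suc zero))       = next-functional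
step-functional (suc (suc (suc zero))) = next-injective

injective⇒surjective : ∀ {n} (f : Fin n → Fin n) → Injective _≡_ _≡_ f → ∀ t → ∃[ k ] f k ≡ t
injective⇒surjective {suc m} f f-injective t with any? (λ k → f k ≟ t)
... | yes hit  = hit
... | no  miss = contradiction (injective⇒≤ squeeze-injective) 1+n≰n
  where
  avoids : ∀ k → t ≢ f k
  avoids k t≡fk = miss (k , sym t≡fk)
  squeeze : Fin (suc m) → Fin m
  squeeze k = punchOut (avoids k)
  squeeze-injective : Injective _≡_ _≡_ squeeze
  squeeze-injective eq = f-injective (punchOut-injective (avoids _) (avoids _) eq)

every-kind : ∀ {n} {σ τ : Permutation′ n} {x} (b : Fin 4 → Fin n) → Injective _≡_ _≡_ b →
  (∀ l → UnionAdj σ τ x (b l)) → ∀ k → ∃[ l ] Step σ τ k x (b l)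
every-kind {σ = σ} {τ} {x} b b-injective adjacent k =
  let (l , kind-l≡k) = injective⇒surjective kind kind-injective k
  in l , subst (λ k′ → Step σ τ k′ x (b l)) kind-l≡k (step l)
  where
  kind : Fin 4 → Fin 4
  kind l = proj₁ (unionAdj⇒step {σ = σ} {τ} (adjacent l))
  step : ∀ l → Step σ τ (kind l) x (b l)
  step l = proj₂ (unionAdj⇒step {σ = σ} {τ} (adjacent l))
  kind-injective : Injective _≡_ _≡_ kind
  kind-injective {l} {l′} eq =
    b-injective (step-functional (kind l) (step l) (subst (λ k′ → Step σ τ k′ x (b l′)) (sym eq) (step l′)))

record Crossing {n} (σ τ : Permutation′ n) : Set where
  constructor crossing
  field
    x y  : Fin n
    x≢y  : x ≢ y
    s    : Fin n
    x→s  : Next σ x s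
    y→s  : Next τ y s
    t    : Fin n
    y→t  : Next σ y t
    x→t  : Next τ x t

module _ {n} {σ τ : Permutation′ n} (c : Fin n → Fin 3)
         (σ-graded : Graded c σ) (τ-graded : Graded c τ) where

  step-graded : ∀ k {u w} → Step σ τ k u w → c w ≡ suc₃ (c u) ⊎ c u ≡ suc₃ (c w)
  step-graded zero                   st = inj₁ (σ-graded st)
  step-graded (suc zero)             st = inj₂ (σ-graded st)
  step-graded (suc (suc zero))       st = inj₁ (τ-graded st)
  step-graded (suc (suc (suc zero))) st = inj₂ (τ-graded st)

  step-distinct : ∀ k {u w} → Step σ τ k u w → c u ≢ c w
  step-distinct k {u} {w} st cu≡cw =
    [ (λ up → suc₃-no-fixpoint (c u) (trans (sym up) (sym cu≡cw)))
    , (λ down → suc₃-no-fixpoint (c w) (trans (sym down) cu≡cw)) ]′ (step-graded k st)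

  forward-step : ∀ k {u w} → c w ≡ suc₃ (c u) → Step σ τ k u w → Next σ u w ⊎ Next τ u w
  forward-step zero                   _  st = inj₁ st
  forward-step (suc (suc zero))       _  st = inj₂ st
  forward-step (suc zero)             {u} up st =
    contradiction (trans (σ-graded st) (cong suc₃ up)) (suc₃-no-2-cycle (c u) ∘ sym)
  forward-step (suc (suc (suc zero))) {u} up st =
    contradiction (trans (τ-graded st) (cong suc₃ up)) (suc₃-no-2-cycle (c u) ∘ sym)

  -- The K_{2,4} has parts {x, y} and {b 0, …, b 3}.  Let s, p, t be the σ-successor,
  -- σ-predecessor and τ-successor of x among the b's.  Since y is adjacent to s (level c x + 1)
  -- and p (level c x + 2), it has level c x; so s and t, one level above y, are forward
  -- neighbours of y, and as x already precedes s in σ and t in τ, y precedes s in τ and t in σ.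
  k24⇒crossing : K24Creating σ τ → Crossing σ τ
  k24⇒crossing (h , h-injective , adjacent) = crossing x y x≢y s x→s y→s t y→t x→t
    where
    x y : Fin n
    x = h (inj₁ zero)
    y = h (inj₁ (suc zero))
    b : Fin 4 → Fin n
    b l = h (inj₂ l)

    x≢y : x ≢ y
    x≢y eq with h-injective eq
    ... | ()

    neighbour : ∀ k → ∃[ l ] Step σ τ k x (b l)
    neighbour = every-kind {σ = σ} {τ} b (inj₂-injective ∘ h-injective) (adjacent zero)

    s p t : Fin n
    s = b (proj₁ (neighbour zero))
    p = b (proj₁ (neighbour (suc zero)))
    t = b (proj₁ (neighbour (suc (suc zero))))
    x→s : Next σ x s
    x→s = proj₂ (neighbour zero)
    p→x : Next σ p x
    p→x = proj₂ (neighbour (suc zero))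
    x→t : Next τ x t
    x→t = proj₂ (neighbour (suc (suc zero)))

    y-step : ∀ l → ∃[ k ] Step σ τ k y (b l)
    y-step l = unionAdj⇒step {σ = σ} {τ} (adjacent (suc zero) l)

    level-p : c p ≡ suc₃ (suc₃ (c x))
    level-p = trans (sym (suc₃-cube (c p))) (cong (suc₃ ∘ suc₃) (sym (σ-graded p→x)))

    level-y : c y ≡ c x
    level-y = remaining-residue (c x) (c y)
      (λ e → avoid (proj₁ (neighbour zero)) (trans e (sym (σ-graded x→s))))
      (λ e → avoid (proj₁ (neighbour (suc zero))) (trans e (sym level-p)))
      where
      avoid : ∀ l → c y ≢ c (b l)
      avoid l = step-distinct (proj₁ (y-step l)) (proj₂ (y-step l))

    forward : ∀ l → c (b l) ≡ suc₃ (c x) → Next σ y (b l) ⊎ Next τ y (b l)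
    forward l up = forward-step (proj₁ (y-step l)) (trans up (cong suc₃ (sym level-y))) (proj₂ (y-step l))

    y→s : Next τ y s
    y→s = [ (λ σ-y→s → contradiction (next-injective x→s σ-y→s) x≢y) , (λ τ-y→s → τ-y→s) ]′
            (forward (proj₁ (neighbour zero)) (σ-graded x→s))

    y→t : Next σ y t
    y→t = [ (λ σ-y→t → σ-y→t) , (λ τ-y→t → contradiction (next-injective x→t τ-y→t) x≢y) ]′
            (forward (proj₁ (neighbour (suc (suc zero)))) (τ-graded x→t))

klein : Fin 3 → Fin 4 → Fin 4
klein zero             t                      = t
klein (suc zero)       zero                   = suc zero
klein (suc zero)       (suc zero)             = zero
klein (suc zero)       (suc (suc zero))       = suc (suc (suc zero))
klein (suc zero)       (suc (suc (suc zero))) = suc (suc zero)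
klein (suc (suc zero)) zero                   = suc (suc zero)
klein (suc (suc zero)) (suc zero)             = suc (suc (suc zero))
klein (suc (suc zero)) (suc (suc zero))       = zero
klein (suc (suc zero)) (suc (suc (suc zero))) = suc zero

klein-involutive : ∀ r t → klein r (klein r t) ≡ t
klein-involutive zero             t                      = refl
klein-involutive (suc zero)       zero                   = refl
klein-involutive (suc zero)       (suc zero)             = refl
klein-involutive (suc zero)       (suc (suc zero))       = refl
klein-involutive (suc zero)       (suc (suc (suc zero))) = refl
klein-involutive (suc (suc zero)) zero                   = refl
klein-involutive (suc (suc zero)) (suc zero)             = refl
klein-involutive (suc (suc zero)) (suc (suc zero))       = refl
klein-involutive (suc (suc zero)) (suc (suc (suc zero))) = refl

kleinPermutation : Fin 3 → Permutation′ 4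
kleinPermutation r = permutation (klein r) (klein r) (klein-involutive r) (klein-involutive r)

klein-reversing : ∀ {r r′} → r ≢ r′ → Reversing (kleinPermutation r) (kleinPermutation r′)
klein-reversing {zero}             {zero}             r≢r′ = contradiction refl r≢r′
klein-reversing {zero}             {suc zero}         _ = zero , suc zero , (λ ()) , refl , refl
klein-reversing {zero}             {suc (suc zero)}   _ = zero , suc (suc zero) , (λ ()) , refl , refl
klein-reversing {suc zero}         {zero}             _ = zero , suc zero , (λ ()) , refl , refl
klein-reversing {suc zero}         {suc zero}         r≢r′ = contradiction refl r≢r′
klein-reversing {suc zero}         {suc (suc zero)}   _ = zero , suc (suc (suc zero)) , (λ ()) , refl , refl
klein-reversing {suc (suc zero)}   {zero}             _ = zero , suc (suc zero) , (λ ()) , refl , refl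
klein-reversing {suc (suc zero)}   {suc zero}         _ = zero , suc (suc (suc zero)) , (λ ()) , refl , refl
klein-reversing {suc (suc zero)}   {suc (suc zero)}   r≢r′ = contradiction refl r≢r′

encodeLayer : ∀ {n} → Permutation′ n → Fin 5 → Permutation′ n
encodeLayer σ zero    = successor σ
encodeLayer σ (suc _) = id

encodeBlock : ∀ {n} → Permutation′ n → Fin n → Permutation′ 5
encodeBlock σ v = lift₀ (kleinPermutation (position₃ σ v))

encode : ∀ {n} → Permutation′ n → Permutation′ (n * 5)
encode σ = acrossBlocks (encodeLayer σ) ∘ₚ withinBlocks (encodeBlock σ)

encode-successor : ∀ {n} (σ : Permutation′ n) v →
  encode σ ⟨$⟩ʳ combine v zero ≡ combine (successor σ ⟨$⟩ʳ v) zero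
encode-successor σ v = trans
  (cong (withinBlocks (encodeBlock σ) ⟨$⟩ʳ_) (acrossBlocks-combine (encodeLayer σ) v zero))
  (withinBlocks-combine (encodeBlock σ) (successor σ ⟨$⟩ʳ v) zero)

encode-klein : ∀ {n} (σ : Permutation′ n) v t →
  encode σ ⟨$⟩ʳ combine v (suc t) ≡ combine v (suc (kleinPermutation (position₃ σ v) ⟨$⟩ʳ t))
encode-klein σ v t = trans
  (cong (withinBlocks (encodeBlock σ) ⟨$⟩ʳ_) (acrossBlocks-combine (encodeLayer σ) v (suc t)))
  (withinBlocks-combine (encodeBlock σ) v (suc t))

module _ {n} {σ τ : Permutation′ n} where

  crossing⇒reversing : Crossing σ τ → Reversing (encode σ) (encode τ)
  crossing⇒reversing (crossing x y x≢y s x→s y→s t y→t x→t) =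
    combine x zero , combine y zero , x≢y ∘ proj₁ ∘ combine-injective x zero y zero ,
    swapped x→s y→s , swapped y→t x→t
    where
    swapped : ∀ {u u′ w} → Next σ u w → Next τ u′ w →
      encode σ ⟨$⟩ʳ combine u zero ≡ encode τ ⟨$⟩ʳ combine u′ zero
    swapped {u} {u′} u→w u′→w = begin
      encode σ ⟨$⟩ʳ combine u zero        ≡⟨ encode-successor σ u ⟩
      combine (successor σ ⟨$⟩ʳ u) zero   ≡⟨ cong (λ z → combine z zero)
                                              (trans (successor-next u→w) (sym (successor-next u′→w))) ⟩
      combine (successor τ ⟨$⟩ʳ u′) zero  ≡⟨ encode-successor τ u′ ⟨
      encode τ ⟨$⟩ʳ combine u′ zero       ∎

  klein⇒reversing : ∀ v → Reversing (kleinPermutation (position₃ σ v)) (kleinPermutation (position₃ τ v)) →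
    Reversing (encode σ) (encode τ)
  klein⇒reversing v (a , b , a≢b , κσa≡κτb , κσb≡κτa) =
    combine v (suc a) , combine v (suc b) ,
    a≢b ∘ fin-suc-injective ∘ proj₂ ∘ combine-injective v (suc a) v (suc b) ,
    in-block κσa≡κτb , in-block κσb≡κτa
    where
    κσ κτ : Permutation′ 4
    κσ = kleinPermutation (position₃ σ v)
    κτ = kleinPermutation (position₃ τ v)
    in-block : ∀ {a b} → κσ ⟨$⟩ʳ a ≡ κτ ⟨$⟩ʳ b →
      encode σ ⟨$⟩ʳ combine v (suc a) ≡ encode τ ⟨$⟩ʳ combine v (suc b)
    in-block {a} {b} κσa≡κτb = begin
      encode σ ⟨$⟩ʳ combine v (suc a)  ≡⟨ encode-klein σ v a ⟩
      combine v (suc (κσ ⟨$⟩ʳ a))      ≡⟨ cong (combine v ∘ suc) κσa≡κτb ⟩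
      combine v (suc (κτ ⟨$⟩ʳ b))      ≡⟨ encode-klein τ v b ⟨
      encode τ ⟨$⟩ʳ combine v (suc b)  ∎

  -- Either the positions mod 3 disagree somewhere (Klein blocks reverse), or they form a
  -- common grading and the K_{2,4} forces a crossing.
  k24⇒reversing : K24Creating σ τ → Reversing (encode σ) (encode τ)
  k24⇒reversing k24 with all? (λ v → position₃ σ v ≟ position₃ τ v)
  ... | yes same = crossing⇒reversing
        (k24⇒crossing (position₃ σ) (position₃-graded σ) (regrade same (position₃-graded τ)) k24)
  ... | no differ =
        let (v , disagree) = ¬∀⟶∃¬ n _ (λ v → position₃ σ v ≟ position₃ τ v) differ
        in klein⇒reversing v (klein-reversing disagree)

-- "Every pairwise R family of permutations of [n] has at most B members";
-- RPBound and HBound are the instances R = Reversing and R = K24Creating.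
Bound : (∀ {n} → Permutation′ n → Permutation′ n → Set) → ℕ → ℕ → Set
Bound R n B = ∀ (m : ℕ) (F : Fin m → Permutation′ n) → PairwiseFam R F → m ≤ B

transfer : ∀ k .{{_ : NonZero k}} {R S : ∀ {n} → Permutation′ n → Permutation′ n → Set}
  (f : ∀ {n} → Permutation′ n → Permutation′ (n * k)) →
  (∀ {n} {π π′ : Permutation′ n} → R π π′ → S (f π) (f π′)) →
  ∀ C → (∀ n → 1 ≤ n → Bound S n (C ^ n)) → ∀ n → 1 ≤ n → Bound R n ((C ^ k) ^ n)
transfer k f preserves C bound n 1≤n m F pairwise = subst (m ≤_) C^nk≡[C^k]^n
  (bound (n * k) (≤-trans 1≤n (m≤m*n n k)) m (λ a → f (F a))
         (λ a b a≢b → preserves (pairwise a b a≢b)))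
  where
  C^nk≡[C^k]^n : C ^ (n * k) ≡ (C ^ k) ^ n
  C^nk≡[C^k]^n = trans (cong (C ^_) (*-comm n k)) (sym (^-*-assoc C k n))

lemma5p8 : (∃[ C ] (0 < C × (∀ (n : ℕ) → 1 ≤ n → RPBound n (C ^ n))))
    ⇔ (∃[ C ] (0 < C × (∀ (n : ℕ) → 1 ≤ n → HBound n (C ^ n))))
lemma5p8 = mk⇔
  (λ { (C , C>0 , rp) → C ^ 5 , m^n>0 C {{>-nonZero C>0}} 5 ,
                        transfer 5 {K24Creating} {Reversing} encode k24⇒reversing C rp })
  (λ { (C , C>0 , h) → C ^ 3 , m^n>0 C {{>-nonZero C>0}} 3 ,
                       transfer 3 {Reversing} {K24Creating} pathOf reversing⇒k24 C h })
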